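{- For every digraph $G$, $\mathrm{d\text{ - }pw}(G)\le\min(\Delta^-(G),\Delta^+(G))\cdot\mathrm{d\text{ - }nw}(G)$.
   Context: Digraphs $G=(V,E)$ are finite with $E\subseteq\{(u,v):u\ne v\}$; $\Delta^+(G),\Delta^-(G)$ are the maximum out-degree and maximum in-degree. A layout is a bijection $\varphi:V\to\{1,\dots,|V|\}$; $L(i,\varphi)=\{u:\varphi(u)\le i\}$, $R(i,\varphi)=\{u:\varphi(u)>i\}$. $\mathrm{d\text{ - }pw}(G)$ is the minimum of $\max|X_i|-1$ over sequences $(X_1,\dots,X_r)$ of subsets of $V$ with $\bigcup X_i=V$, for each $(u,v)\in E$ some $i\le j$ with $u\in X_i,v\in X_j$, and $X_i\cap X_\ell\subseteq X_j$ for $i<j<\ell$. With $N_i(u)=(\{v\in R(i,\varphi):(u,v)\in E\},\{v\in R(i,\varphi):(v,u)\in E\})$, $\mathrm{d\text{ - }nw}(G)=\min_\varphi\max_i|\{N_i(u):u\in L(i,\varphi)\}|$. -}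

module Defs where

open import Data.Bool using (Bool; true; false; _∧_)
open import Data.Bool.Properties using () renaming (_≟_ to _≟𝔹_)
open import Data.Nat using (ℕ; zero; suc; _+_; _*_; _⊔_; _⊓_; _≤_; _<ᵇ_; _≤ᵇ_)
open import Data.Fin using (Fin; toℕ) renaming (_≤_ to _≤ᶠ_; _<_ to _<ᶠ_)
open import Data.Fin.Subset using (Subset; _∈_; ∣_∣)
open import Data.Fin.Permutation using (Permutation′; _⟨$⟩ʳ_)
open import Data.List using (List; length; map; foldr; filterᵇ; allFin; upTo; deduplicate)
open import Data.Vec using (tabulate)
import Data.Vec.Properties as VecP
import Data.Product.Properties as ProdP
open import Data.Product using (_×_; _,_; Σ; ∃; ∃-syntax)
open import Relation.Binary.PropositionalEquality using (_≡_)
open import Relation.Binary.Definitions using (DecidableEquality)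

record Digraph : Set where
  field
    n        : ℕ
    E        : Fin n → Fin n → Bool
    loopless : ∀ u → E u u ≡ false
open Digraph public

maxList : List ℕ → ℕ
maxList = foldr _⊔_ 0

outdeg : (G : Digraph) → Fin (n G) → ℕ
outdeg G u = length (filterᵇ (λ v → E G u v) (allFin (n G)))

indeg : (G : Digraph) → Fin (n G) → ℕ
indeg G u = length (filterᵇ (λ v → E G v u) (allFin (n G)))

Δ⁺ : Digraph → ℕ
Δ⁺ G = maxList (map (outdeg G) (allFin (n G)))

Δ⁻ : Digraph → ℕ
Δ⁻ G = maxList (map (indeg G) (allFin (n G)))

record DirPathDecomp (G : Digraph) : Set where
  field
    r      : ℕ
    X      : Fin r → Subset (n G)
    cover  : ∀ v → ∃[ i ] (v ∈ X i)
    edges  : ∀ u v → E G u v ≡ true →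
             ∃[ i ] ∃[ j ] (i ≤ᶠ j × u ∈ X i × v ∈ X j)
    interp : ∀ i j l → i <ᶠ j → j <ᶠ l → ∀ v → v ∈ X i → v ∈ X l → v ∈ X j
open DirPathDecomp public

width : ∀ {G} → DirPathDecomp G → ℕ
width {G} D = maxList (map (λ i → ∣ X D i ∣) (allFin (r D))) Data.Nat.∸ 1

dpw≤ : Digraph → ℕ → Set
dpw≤ G k = Σ (DirPathDecomp G) (λ D → width D ≤ k)

-- Layouts and neighbourhood width.
-- A layout is a bijection V → Fin n; position φ(u) ∈ {1..n} of the paper
-- is toℕ (φ ⟨$⟩ʳ u) + 1 here.

Layout : Digraph → Set
Layout G = Permutation′ (n G)

module _ (G : Digraph) (φ : Layout G) where
  pos : Fin (n G) → ℕ
  pos u = suc (toℕ (φ ⟨$⟩ʳ u))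

  inL : ℕ → Fin (n G) → Bool
  inL i u = pos u ≤ᵇ i

  inR : ℕ → Fin (n G) → Bool
  inR i u = i <ᵇ pos u

  N : ℕ → Fin (n G) → Subset (n G) × Subset (n G)
  N i u = tabulate (λ v → E G u v ∧ inR i v) , tabulate (λ v → E G v u ∧ inR i v)

  _≟N_ : DecidableEquality (Subset (n G) × Subset (n G))
  _≟N_ = ProdP.≡-dec (VecP.≡-dec _≟𝔹_) (VecP.≡-dec _≟𝔹_)

  classes : ℕ → ℕ
  classes i = length (deduplicate _≟N_ (map (N i) (filterᵇ (inL i) (allFin (n G)))))

  nw : ℕ
  nw = maxList (map (λ j → classes (suc j)) (upTo (n G)))

module Submission where

-- Both bounds come from "interval" decompositions along the layout: give each
-- vertex v an interval [lo v, hi v] of positions containing its own position,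
-- and let bag k collect the vertices whose interval contains k.  Such a family
-- is a directed path decomposition as soon as every backward edge u → v
-- (v placed before u) has an interval reaching across the edge (Intervals).
--
--  * hi v = position of the rightmost in-neighbour of v.  Besides the vertex at
--    position k, bag k holds vertices v left of the cut k having an in-neighbour
--    right of it; those v with the same neighbourhood class at that cut are all
--    out-neighbours of one common vertex, so bag k has ≤ 1 + Δ⁺ · nw elements.
--  * lo w = position of the leftmost out-neighbour of w.  Now bag k holds, apart
--    from the vertex at k, vertices w right of the cut k+1 with an out-neighbour
--    v left of it, i.e. w lies in the in-part of the class of v; each in-part
--    has ≤ Δ⁻ elements, so bag k has ≤ 1 + Δ⁻ · nw elements.

open import Defs
open import Data.Bool using (Bool; true; false; T; _∧_)
open import Data.Bool.Properties using (T-∧; T-≡)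
open import Data.Nat using (ℕ; zero; suc; _+_; _*_; _⊓_; _≤_; _<_; _≤ᵇ_; z≤n; s≤s; _≤?_)
open import Data.Nat.Properties
open import Data.Fin using (Fin; toℕ)
import Data.Fin as Fin
open import Data.Fin.Properties using (toℕ-injective; toℕ<n)
open import Data.Fin.Subset using (Subset; ∣_∣; ⁅_⁆; _∪_; ⋃; _⊆_)
  renaming (_∈_ to _∈ₛ_; ⊥ to ∅)
open import Data.Fin.Subset.Properties
  using (x∈p∪q⁺; x∈⁅x⁆; ∣⁅x⁆∣≡1; ∣⊥∣≡0; p⊆q⇒∣p∣≤∣q∣; nonempty?)
open import Data.Fin.Permutation using (_⟨$⟩ʳ_; _⟨$⟩ˡ_; inverseˡ)
open import Data.List using (List; []; _∷_; length; map; filterᵇ; allFin; deduplicate)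
import Data.List as List
import Data.List.Properties as ListP
open import Data.List.Membership.Propositional using (_∈_)
open import Data.List.Membership.Propositional.Properties
  using (∈-map⁺; ∈-map⁻; ∈-filter⁺; ∈-filter⁻; ∈-deduplicate⁺; ∈-deduplicate⁻; ∈-allFin; ∈-upTo⁺)
open import Data.List.Relation.Unary.Any using (here; there)
import Data.List.Relation.Unary.Any as Any
import Data.List.Relation.Unary.All as All
open import Data.List.Extrema.Nat
  using (argmax; argmin; argmax-sel; argmin-sel; f[⊥]≤f[argmax]; f[xs]≤f[argmax]; f[argmin]≤f[⊤]; f[argmin]≤f[xs])
open import Data.Vec using (_∷_; []; tabulate)
import Data.Vec.Properties as VecP
open import Data.Product using (_×_; _,_; proj₁; proj₂; ∃-syntax)
open import Data.Sum using (_⊎_; inj₁; inj₂; [_,_])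
open import Function using (_∘_; id)
open import Function.Bundles using (Equivalence)
open import Relation.Binary.PropositionalEquality using (_≡_; refl; sym; trans; cong; subst)
open import Relation.Nullary using (yes; no; contradiction)
open import Relation.Nullary.Decidable using (T?)

open Equivalence using (to; from)

∈-tabulate⁺ : ∀ {m} {f : Fin m → Bool} {v} → T (f v) → v ∈ₛ tabulate f
∈-tabulate⁺ {f = f} {v} fv =
  VecP.lookup⇒[]= v (tabulate f) (trans (VecP.lookup∘tabulate f v) (to T-≡ fv))

∈-tabulate⁻ : ∀ {m} {f : Fin m → Bool} {v} → v ∈ₛ tabulate f → T (f v)
∈-tabulate⁻ {f = f} {v} v∈ =
  from T-≡ (trans (sym (VecP.lookup∘tabulate f v)) (VecP.[]=⇒lookup v∈))

∣tabulate∣≡length-filter : ∀ {m} (f : Fin m → Bool) →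
                           ∣ tabulate f ∣ ≡ length (filterᵇ f (allFin m))
∣tabulate∣≡length-filter {m} f = along id
  where
  along : ∀ {k} (g : Fin k → Fin m) →
          ∣ tabulate (f ∘ g) ∣ ≡ length (filterᵇ f (List.tabulate g))
  along {zero}  g = refl
  along {suc k} g with f (g Fin.zero)
  ... | true  = cong suc (along (g ∘ Fin.suc))
  ... | false = along (g ∘ Fin.suc)

∣p∪q∣≤∣p∣+∣q∣ : ∀ {m} (p q : Subset m) → ∣ p ∪ q ∣ ≤ ∣ p ∣ + ∣ q ∣
∣p∪q∣≤∣p∣+∣q∣ []          []          = z≤n
∣p∪q∣≤∣p∣+∣q∣ (true ∷ p)  (true ∷ q)  =
  s≤s (≤-trans (∣p∪q∣≤∣p∣+∣q∣ p q) (+-monoʳ-≤ ∣ p ∣ (n≤1+n ∣ q ∣)))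
∣p∪q∣≤∣p∣+∣q∣ (true ∷ p)  (false ∷ q) = s≤s (∣p∪q∣≤∣p∣+∣q∣ p q)
∣p∪q∣≤∣p∣+∣q∣ (false ∷ p) (true ∷ q)  =
  ≤-trans (s≤s (∣p∪q∣≤∣p∣+∣q∣ p q)) (≤-reflexive (sym (+-suc ∣ p ∣ ∣ q ∣)))
∣p∪q∣≤∣p∣+∣q∣ (false ∷ p) (false ∷ q) = ∣p∪q∣≤∣p∣+∣q∣ p q

∣⋃∣≤length*d : ∀ {A : Set} {m d} (h : A → Subset m) (Ss : List A) →
               (∀ {S} → S ∈ Ss → ∣ h S ∣ ≤ d) → ∣ ⋃ (map h Ss) ∣ ≤ length Ss * d
∣⋃∣≤length*d {m = m} h []       _     = ≤-reflexive (∣⊥∣≡0 m)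
∣⋃∣≤length*d         h (S ∷ Ss) bound =
  ≤-trans (∣p∪q∣≤∣p∣+∣q∣ (h S) (⋃ (map h Ss)))
          (+-mono-≤ (bound (here refl)) (∣⋃∣≤length*d h Ss (λ S∈ → bound (there S∈))))

∈-⋃⁺ : ∀ {A : Set} {m} {v : Fin m} (h : A → Subset m) {S Ss} →
       S ∈ Ss → v ∈ₛ h S → v ∈ₛ ⋃ (map h Ss)
∈-⋃⁺ h (here refl) v∈ = x∈p∪q⁺ (inj₁ v∈)
∈-⋃⁺ h (there S∈)  v∈ = x∈p∪q⁺ (inj₂ (∈-⋃⁺ h S∈ v∈))

cover-card : ∀ {A : Set} {m d} (B : Subset m) (x : Fin m) (h : A → Subset m) (Ss : List A) →
             (∀ {v} → v ∈ₛ B → v ≡ x ⊎ ∃[ S ] (S ∈ Ss × v ∈ₛ h S)) →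
             (∀ {S} → S ∈ Ss → ∣ h S ∣ ≤ d) → ∣ B ∣ ≤ suc (length Ss * d)
cover-card {d = d} B x h Ss cover bound = begin
  ∣ B ∣                           ≤⟨ p⊆q⇒∣p∣≤∣q∣ B⊆ ⟩
  ∣ ⁅ x ⁆ ∪ ⋃ (map h Ss) ∣        ≤⟨ ∣p∪q∣≤∣p∣+∣q∣ ⁅ x ⁆ (⋃ (map h Ss)) ⟩
  ∣ ⁅ x ⁆ ∣ + ∣ ⋃ (map h Ss) ∣    ≡⟨ cong (_+ ∣ ⋃ (map h Ss) ∣) (∣⁅x⁆∣≡1 x) ⟩
  suc ∣ ⋃ (map h Ss) ∣            ≤⟨ s≤s (∣⋃∣≤length*d h Ss bound) ⟩
  suc (length Ss * d)             ∎
  where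
  open ≤-Reasoning
  B⊆ : B ⊆ ⁅ x ⁆ ∪ ⋃ (map h Ss)
  B⊆ v∈ with cover v∈
  ... | inj₁ refl              = x∈p∪q⁺ (inj₁ (x∈⁅x⁆ x))
  ... | inj₂ (S , S∈ , v∈hS) = x∈p∪q⁺ (inj₂ (∈-⋃⁺ h S∈ v∈hS))

maxList-upper : ∀ {x} xs → x ∈ xs → x ≤ maxList xs
maxList-upper {x} xs x∈ =
  ListP.foldr-preservesᵒ {P = x ≤_} (λ a b → [ m≤n⇒m≤n⊔o b , m≤n⇒m≤o⊔n a ]) 0 xs
                         (inj₂ (Any.map (λ { refl → ≤-refl }) x∈))

maxList-least : ∀ {b} xs → (∀ {x} → x ∈ xs → x ≤ b) → maxList xs ≤ b
maxList-least {b} xs ub = ListP.foldr-preservesᵇ {P = _≤ b} ⊔-lub z≤n (All.tabulate ub)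

width≤ : ∀ {G} (D : DirPathDecomp G) {K} → (∀ i → ∣ X D i ∣ ≤ suc K) → width D ≤ K
width≤ D {K} bag≤ = ∸-monoˡ-≤ 1 (maxList-least _ bagSize≤)
  where
  bagSize≤ : ∀ {x} → x ∈ map (λ i → ∣ X D i ∣) (allFin (r D)) → x ≤ suc K
  bagSize≤ x∈ with ∈-map⁻ _ x∈
  ... | i , _ , refl = bag≤ i

module Degrees (G : Digraph) where

  inNbrs : Fin (n G) → Subset (n G)
  inNbrs v = tabulate (λ w → E G w v)

  outNbrs : Fin (n G) → Subset (n G)
  outNbrs u = tabulate (E G u)

  ∣inNbrs∣≤Δ⁻ : ∀ v → ∣ inNbrs v ∣ ≤ Δ⁻ G
  ∣inNbrs∣≤Δ⁻ v = ≤-trans (≤-reflexive (∣tabulate∣≡length-filter (λ w → E G w v)))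
                          (maxList-upper _ (∈-map⁺ (indeg G) (∈-allFin v)))

  ∣outNbrs∣≤Δ⁺ : ∀ u → ∣ outNbrs u ∣ ≤ Δ⁺ G
  ∣outNbrs∣≤Δ⁺ u = ≤-trans (≤-reflexive (∣tabulate∣≡length-filter (E G u)))
                           (maxList-upper _ (∈-map⁺ (outdeg G) (∈-allFin u)))

-- Bags along a vertex's interval are contiguous, so only
-- backward edges need a hypothesis: one endpoint's interval must reach the
-- position of the other.
module Intervals (G : Digraph) {r : ℕ} (pos : Fin (n G) → Fin r) (lo hi : Fin (n G) → ℕ)
  (lo≤pos : ∀ v → lo v ≤ toℕ (pos v)) (pos≤hi : ∀ v → toℕ (pos v) ≤ hi v)
  (backward : ∀ {u v} → T (E G u v) → toℕ (pos v) < toℕ (pos u) →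
              lo u ≤ toℕ (pos v) ⊎ toℕ (pos u) ≤ hi v)
  where

  bag : Fin r → Subset (n G)
  bag i = tabulate (λ v → (lo v ≤ᵇ toℕ i) ∧ (toℕ i ≤ᵇ hi v))

  ∈bag⁺ : ∀ {v i} → lo v ≤ toℕ i → toℕ i ≤ hi v → v ∈ₛ bag i
  ∈bag⁺ lo≤i i≤hi = ∈-tabulate⁺ (from T-∧ (≤⇒≤ᵇ lo≤i , ≤⇒≤ᵇ i≤hi))

  ∈bag⁻ : ∀ {v i} → v ∈ₛ bag i → lo v ≤ toℕ i × toℕ i ≤ hi v
  ∈bag⁻ {v} {i} v∈ with to T-∧ (∈-tabulate⁻ v∈)
  ... | lo≤i , i≤hi = ≤ᵇ⇒≤ (lo v) (toℕ i) lo≤i , ≤ᵇ⇒≤ (toℕ i) (hi v) i≤hi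

  own : ∀ v → v ∈ₛ bag (pos v)
  own v = ∈bag⁺ (lo≤pos v) (pos≤hi v)

  decomposition : DirPathDecomp G
  decomposition = record
    { r = r ; X = bag ; cover = λ v → pos v , own v ; edges = covers-edges ; interp = interpolates }
    where
    covers-edges : ∀ u v → E G u v ≡ true →
            ∃[ i ] ∃[ j ] (toℕ i ≤ toℕ j × u ∈ₛ bag i × v ∈ₛ bag j)
    covers-edges u v e with toℕ (pos u) ≤? toℕ (pos v)
    ... | yes forward = pos u , pos v , forward , own u , own v
    ... | no ¬forward with backward (from T-≡ e) (≰⇒> ¬forward)
    ...   | inj₁ lo≤ = pos v , pos v , ≤-refl ,
                       ∈bag⁺ lo≤ (≤-trans (<⇒≤ (≰⇒> ¬forward)) (pos≤hi u)) , own v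
    ...   | inj₂ ≤hi = pos u , pos u , ≤-refl ,
                       own u , ∈bag⁺ (≤-trans (lo≤pos v) (<⇒≤ (≰⇒> ¬forward))) ≤hi
    interpolates : ∀ i j l → toℕ i < toℕ j → toℕ j < toℕ l →
             ∀ v → v ∈ₛ bag i → v ∈ₛ bag l → v ∈ₛ bag j
    interpolates i j l i<j j<l v v∈i v∈l =
      ∈bag⁺ (≤-trans (proj₁ (∈bag⁻ v∈i)) (<⇒≤ i<j)) (≤-trans (<⇒≤ j<l) (proj₂ (∈bag⁻ v∈l)))

-- Positions in the layout φ (0-based: the paper's φ(v) is p v + 1), the
-- neighbourhood classes at a cut, and how they bound bag sizes.
module LayoutFacts (G : Digraph) (φ : Layout G) where
  open Degrees G

  p : Fin (n G) → ℕ
  p v = toℕ (φ ⟨$⟩ʳ v)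

  vertexAt : Fin (n G) → Fin (n G)
  vertexAt i = φ ⟨$⟩ˡ i

  vertexAt-unique : ∀ {v} i → p v ≡ toℕ i → v ≡ vertexAt i
  vertexAt-unique i eq = trans (sym (inverseˡ φ)) (cong (φ ⟨$⟩ˡ_) (toℕ-injective eq))

  Nbhd : Set
  Nbhd = Subset (n G) × Subset (n G)

  Classes : ℕ → List Nbhd
  Classes c = deduplicate (_≟N_ G φ) (map (N G φ c) (filterᵇ (inL G φ c) (allFin (n G))))

  class∈Classes : ∀ {c v} → p v < c → N G φ c v ∈ Classes c
  class∈Classes {c} {v} pv<c = ∈-deduplicate⁺ (_≟N_ G φ)
    (∈-map⁺ (N G φ c) (∈-filter⁺ (T? ∘ inL G φ c) (∈-allFin v) (≤⇒≤ᵇ pv<c)))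

  Classes-elem : ∀ {c S} → S ∈ Classes c → ∃[ v ] (S ≡ N G φ c v)
  Classes-elem {c} S∈ with ∈-map⁻ (N G φ c) (∈-deduplicate⁻ (_≟N_ G φ) _ S∈)
  ... | v , _ , S≡ = v , S≡

  -- Every cut 0 … |V| has at most nw classes; the cut 0 has none, as L(0,φ) = ∅.
  classes≤nw : ∀ {c} → c ≤ n G → classes G φ c ≤ nw G φ
  classes≤nw {zero} _
    rewrite ListP.filter-none (T? ∘ inL G φ 0) (All.universal (λ _ ()) (allFin (n G))) = z≤n
  classes≤nw {suc j} j<n = maxList-upper _ (∈-map⁺ (λ k → classes G φ (suc k)) (∈-upTo⁺ j<n))

  ∈in-part⁺ : ∀ {c v w} → T (E G w v) → c ≤ p w → w ∈ₛ proj₂ (N G φ c v)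
  ∈in-part⁺ e c≤pw = ∈-tabulate⁺ (from T-∧ (e , <⇒<ᵇ (s≤s c≤pw)))

  ∈in-part⁻ : ∀ {c v w} → w ∈ₛ proj₂ (N G φ c v) → T (E G w v)
  ∈in-part⁻ w∈ = proj₁ (to T-∧ (∈-tabulate⁻ w∈))

  ∣in-part∣≤Δ⁻ : ∀ {c S} → S ∈ Classes c → ∣ proj₂ S ∣ ≤ Δ⁻ G
  ∣in-part∣≤Δ⁻ {c} S∈ with Classes-elem {c} S∈
  ... | v , refl = ≤-trans (p⊆q⇒∣p∣≤∣q∣ (λ w∈ → ∈-tabulate⁺ (∈in-part⁻ {c} w∈))) (∣inNbrs∣≤Δ⁻ v)

  class-cover-bound : ∀ {c d} (B : Subset (n G)) (x : Fin (n G)) (h : Nbhd → Subset (n G)) →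
                      c ≤ n G →
                      (∀ {v} → v ∈ₛ B → v ≡ x ⊎ ∃[ S ] (S ∈ Classes c × v ∈ₛ h S)) →
                      (∀ {S} → S ∈ Classes c → ∣ h S ∣ ≤ d) → ∣ B ∣ ≤ suc (d * nw G φ)
  class-cover-bound {c} {d} B x h c≤n cover bound = begin
    ∣ B ∣                     ≤⟨ cover-card B x h (Classes c) cover bound ⟩
    suc (classes G φ c * d)  ≤⟨ s≤s (*-monoˡ-≤ d (classes≤nw c≤n)) ⟩
    suc (nw G φ * d)         ≡⟨ cong suc (*-comm (nw G φ) d) ⟩
    suc (d * nw G φ)         ∎
    where open ≤-Reasoning

module RightmostInNeighbour (G : Digraph) (φ : Layout G) where
  open Degrees G
  open LayoutFacts G φ

  inList : Fin (n G) → List (Fin (n G))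
  inList v = filterᵇ (λ w → E G w v) (allFin (n G))

  -- The rightmost in-neighbour of v, or v itself if it has none further right.
  lastIn : Fin (n G) → Fin (n G)
  lastIn v = argmax p v (inList v)

  lastIn-sel : ∀ v → lastIn v ≡ v ⊎ T (E G (lastIn v) v)
  lastIn-sel v with argmax-sel p v (inList v)
  ... | inj₁ last≡v = inj₁ last≡v
  ... | inj₂ last∈  = inj₂ (proj₂ (∈-filter⁻ (λ w → T? (E G w v)) {xs = allFin (n G)} last∈))

  in-neighbour≤lastIn : ∀ {u v} → T (E G u v) → p u ≤ p (lastIn v)
  in-neighbour≤lastIn {u} {v} e = All.lookup (f[xs]≤f[argmax] {f = p} v (inList v))
    (∈-filter⁺ (λ w → T? (E G w v)) (∈-allFin u) e)

  open Intervals G (φ ⟨$⟩ʳ_) p (p ∘ lastIn) (λ _ → ≤-refl)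
    (λ v → f[⊥]≤f[argmax] {f = p} v (inList v)) (λ e _ → inj₂ (in-neighbour≤lastIn e))

  -- All vertices of one class with non-empty in-part share an in-neighbour,
  -- hence are out-neighbours of a chosen member of that in-part.
  outOfInPart : Nbhd → Subset (n G)
  outOfInPart S with nonempty? (proj₂ S)
  ... | yes (w , _) = outNbrs w
  ... | no _        = ∅

  ∣outOfInPart∣≤Δ⁺ : ∀ S → ∣ outOfInPart S ∣ ≤ Δ⁺ G
  ∣outOfInPart∣≤Δ⁺ S with nonempty? (proj₂ S)
  ... | yes (w , _) = ∣outNbrs∣≤Δ⁺ w
  ... | no _        = ≤-trans (≤-reflexive (∣⊥∣≡0 (n G))) z≤n

  ∈outOfInPart : ∀ {c v w} → w ∈ₛ proj₂ (N G φ c v) → v ∈ₛ outOfInPart (N G φ c v)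
  ∈outOfInPart {c} {v} w∈ with nonempty? (proj₂ (N G φ c v))
  ... | yes (_ , w′∈) = ∈-tabulate⁺ (∈in-part⁻ {c} w′∈)
  ... | no none       = contradiction (_ , w∈) none

  -- A member of bag k other than the vertex at k lies left of the cut k and its
  -- rightmost in-neighbour lies right of it.
  bag-cover : ∀ i {v} → v ∈ₛ bag i →
              v ≡ vertexAt i ⊎ ∃[ S ] (S ∈ Classes (toℕ i) × v ∈ₛ outOfInPart S)
  bag-cover i {v} v∈ with ∈bag⁻ v∈
  ... | pv≤i , i≤last with m≤n⇒m<n∨m≡n pv≤i
  ... | inj₂ pv≡i = inj₁ (vertexAt-unique i pv≡i)
  ... | inj₁ pv<i with lastIn-sel v
  ...   | inj₁ last≡v = contradiction (subst (λ w → toℕ i ≤ p w) last≡v i≤last) (<⇒≱ pv<i)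
  ...   | inj₂ e      = inj₂ (N G φ (toℕ i) v , class∈Classes pv<i ,
                              ∈outOfInPart {toℕ i} {v} (∈in-part⁺ {toℕ i} {v} e i≤last))

  dpw≤Δ⁺*nw : dpw≤ G (Δ⁺ G * nw G φ)
  dpw≤Δ⁺*nw = decomposition , width≤ decomposition (λ i →
    class-cover-bound (bag i) (vertexAt i) outOfInPart (<⇒≤ (toℕ<n i)) (bag-cover i)
                      (λ {S} _ → ∣outOfInPart∣≤Δ⁺ S))

module LeftmostOutNeighbour (G : Digraph) (φ : Layout G) where
  open LayoutFacts G φ

  outList : Fin (n G) → List (Fin (n G))
  outList u = filterᵇ (E G u) (allFin (n G))

  -- The leftmost out-neighbour of w, or w itself if it has none further left.
  firstOut : Fin (n G) → Fin (n G)
  firstOut w = argmin p w (outList w)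

  firstOut-sel : ∀ w → firstOut w ≡ w ⊎ T (E G w (firstOut w))
  firstOut-sel w with argmin-sel p w (outList w)
  ... | inj₁ first≡w = inj₁ first≡w
  ... | inj₂ first∈  = inj₂ (proj₂ (∈-filter⁻ (λ v → T? (E G w v)) {xs = allFin (n G)} first∈))

  firstOut≤out-neighbour : ∀ {u v} → T (E G u v) → p (firstOut u) ≤ p v
  firstOut≤out-neighbour {u} {v} e = All.lookup (f[argmin]≤f[xs] {f = p} u (outList u))
    (∈-filter⁺ (λ w → T? (E G u w)) (∈-allFin v) e)

  open Intervals G (φ ⟨$⟩ʳ_) (p ∘ firstOut) p (λ w → f[argmin]≤f[⊤] {f = p} w (outList w))
    (λ _ → ≤-refl) (λ e _ → inj₁ (firstOut≤out-neighbour e))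

  -- A member w of bag k other than the vertex at k lies right of the cut k + 1
  -- and its leftmost out-neighbour v left of it, so w is in the in-part of N_{k+1}(v).
  bag-cover : ∀ i {w} → w ∈ₛ bag i →
              w ≡ vertexAt i ⊎ ∃[ S ] (S ∈ Classes (suc (toℕ i)) × w ∈ₛ proj₂ S)
  bag-cover i {w} w∈ with ∈bag⁻ w∈
  ... | first≤i , i≤pw with m≤n⇒m<n∨m≡n i≤pw
  ... | inj₂ i≡pw = inj₁ (vertexAt-unique i (sym i≡pw))
  ... | inj₁ i<pw with firstOut-sel w
  ...   | inj₁ first≡w = contradiction (subst (λ v → p v ≤ toℕ i) first≡w first≤i) (<⇒≱ i<pw)
  ...   | inj₂ e       = inj₂ (N G φ (suc (toℕ i)) (firstOut w) , class∈Classes (s≤s first≤i) ,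
                               ∈in-part⁺ {suc (toℕ i)} {firstOut w} e i<pw)

  dpw≤Δ⁻*nw : dpw≤ G (Δ⁻ G * nw G φ)
  dpw≤Δ⁻*nw = decomposition , width≤ decomposition (λ i →
    class-cover-bound (bag i) (vertexAt i) proj₂ (toℕ<n i) (bag-cover i)
                      (∣in-part∣≤Δ⁻ {suc (toℕ i)}))

lemma5p13 : (G : Digraph) (φ : Layout G) → dpw≤ G ((Δ⁻ G ⊓ Δ⁺ G) * nw G φ)
lemma5p13 G φ with ⊓-sel (Δ⁻ G) (Δ⁺ G)
... | inj₁ min≡Δ⁻ = subst (λ d → dpw≤ G (d * nw G φ)) (sym min≡Δ⁻) (LeftmostOutNeighbour.dpw≤Δ⁻*nw G φ)
... | inj₂ min≡Δ⁺ = subst (λ d → dpw≤ G (d * nw G φ)) (sym min≡Δ⁺) (RightmostInNeighbour.dpw≤Δ⁺*nw G φ)
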